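{- Let $\langle B,f\rangle$ be a modal algebra which is subdirectly irreducible and in which $f$ is a closure operator. Then $f$ has a proper companion.
   Context: A modal algebra is $\langle B,f\rangle$ with $B$ a nontrivial Boolean algebra and $f:B\to B$ satisfying $f(0)=0$, $f(x+y)=f(x)+f(y)$. $f$ is a closure operator if moreover $x\le f(x)$ and $f(f(x))=f(x)$ for all $x$. A companion of $f$ is a modal operator $g$ on $B$ with $f(x)+g(x)=1$ for all $x\neq0$; it is proper if $g$ is not the unary discriminator (the map sending $0$ to $0$ and every nonzero element to $1$). -}

module Defs where

open import Level using (Level; _⊔_; suc)
open import Data.Product using (Σ; _×_; ∃; ∃-syntax)
open import Relation.Nullary using (¬_)
open import Relation.Binary.Core using (Rel)
open import Relation.Binary.Structures using (IsEquivalence)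
open import Algebra.Core using (Op₁)
open import Algebra.Lattice.Bundles using (BooleanAlgebra)

module _ {c ℓ : Level} (B : BooleanAlgebra c ℓ) where
  open BooleanAlgebra B renaming (¬_ to compl)

  Nontrivial : Set ℓ
  Nontrivial = ¬ (⊤ ≈ ⊥)

  record IsModalOperator (f : Op₁ Carrier) : Set (c ⊔ ℓ) where
    field
      cong    : ∀ {x y} → x ≈ y → f x ≈ f y
      normal  : f ⊥ ≈ ⊥
      additive : ∀ x y → f (x ∨ y) ≈ (f x ∨ f y)

  _≤_ : Carrier → Carrier → Set ℓ
  x ≤ y = (x ∨ y) ≈ y

  IsClosureOperator : Op₁ Carrier → Set (c ⊔ ℓ)
  IsClosureOperator f = (∀ x → x ≤ f x) × (∀ x → f (f x) ≈ f x)

  record IsCongruence (f : Op₁ Carrier) (θ : Rel Carrier (c ⊔ ℓ)) : Set (c ⊔ ℓ) where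
    field
      isEquivalence : IsEquivalence θ
      ≈⇒θ : ∀ {x y} → x ≈ y → θ x y
      ∨-cong : ∀ {x y u v} → θ x y → θ u v → θ (x ∨ u) (y ∨ v)
      ∧-cong : ∀ {x y u v} → θ x y → θ u v → θ (x ∧ u) (y ∧ v)
      ¬-cong : ∀ {x y} → θ x y → θ (compl x) (compl y)
      f-cong : ∀ {x y} → θ x y → θ (f x) (f y)

  -- subdirectly irreducible: there is a pair a ≠ b identified by every
  -- congruence other than the identity congruence (i.e. a monolith exists)
  SubdirectlyIrreducible : Op₁ Carrier → Set (suc (c ⊔ ℓ))
  SubdirectlyIrreducible f =
    Σ Carrier λ a → Σ Carrier λ b → ¬ (a ≈ b) ×
      ((θ : Rel Carrier (c ⊔ ℓ)) → IsCongruence f θ →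
         (∃[ x ] ∃[ y ] (θ x y × ¬ (x ≈ y))) → θ a b)

  IsCompanion : Op₁ Carrier → Op₁ Carrier → Set (c ⊔ ℓ)
  IsCompanion f g = IsModalOperator g × (∀ x → ¬ (x ≈ ⊥) → (f x ∨ g x) ≈ ⊤)

  IsDiscriminator : Op₁ Carrier → Set (c ⊔ ℓ)
  IsDiscriminator g = (g ⊥ ≈ ⊥) × (∀ x → ¬ (x ≈ ⊥) → g x ≈ ⊤)

  HasProperCompanion : Op₁ Carrier → Set (c ⊔ ℓ)
  HasProperCompanion f = Σ (Op₁ Carrier) λ g → IsCompanion f g × ¬ IsDiscriminator g

{-# OPTIONS --safe #-}
-- For an element d with f d ≤ d, identifying x and y when x ∨ d = y ∨ d
-- (collapsing the ideal ↓d) is a congruence of ⟨B, f⟩, and a nontrivial one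
-- if d ≠ 0. So if a ≠ b are identified by every nontrivial congruence, then
-- a ⊕ b lies below every nonzero f-closed element, in particular below f x
-- for every x ≠ 0 because f is a closure operator. Hence the operator sending
-- 0 to 0 and every other element to ¬ (a ⊕ b) is a companion of f, and it is
-- not the discriminator because a ⊕ b ≠ 0.
module Submission where

open import Defs
open import Level using (Level; _⊔_; Lift; lift; lower)
open import Algebra.Core using (Op₁)
open import Algebra.Bundles using (Group; IdempotentCommutativeMonoid)
open import Algebra.Lattice.Bundles using (BooleanAlgebra)
open import Axiom.ExcludedMiddle using (ExcludedMiddle)
open import Data.Product using (_,_; ∃-syntax; _×_)
open import Function using (_∘_)
open import Relation.Binary.Core using (Rel)
open import Relation.Nullary using (Dec; yes; no; contradiction)
open import Relation.Nullary.Decidable using (map′)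
import Algebra.Lattice.Properties.BooleanAlgebra as BooleanAlgebraProperties
import Algebra.Lattice.Properties.Lattice as LatticeProperties
import Algebra.Properties.Group as GroupProperties
import Algebra.Properties.IdempotentCommutativeMonoid as ICMProperties
import Relation.Binary.Reasoning.Setoid as SetoidReasoning

module BooleanAlgebraFacts {c ℓ : Level} (B : BooleanAlgebra c ℓ) where

  open BooleanAlgebra B
  open BooleanAlgebraProperties B
    using (∨-identityˡ; ∨-identityʳ; ∨-zeroʳ; ∧-identityʳ; ∧-zeroʳ;
           ¬-involutive; ¬⊤≈⊥; ∨-⊥-isCommutativeMonoid; _⊕_; module DefaultXorRing)
  open DefaultXorRing using (⊕-cong; ⊕-inverseʳ; ∧-distribʳ-⊕; ⊕-⊥-isGroup)
  open LatticeProperties lattice using (∨-idem)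
  open SetoidReasoning setoid

  ∨-⊥-idempotentCommutativeMonoid : IdempotentCommutativeMonoid c ℓ
  ∨-⊥-idempotentCommutativeMonoid = record
    { isIdempotentCommutativeMonoid = record
      { isCommutativeMonoid = ∨-⊥-isCommutativeMonoid ; idem = ∨-idem } }

  ⊕-⊥-group : Group c ℓ
  ⊕-⊥-group = record { isGroup = ⊕-⊥-isGroup }

  open ICMProperties ∨-⊥-idempotentCommutativeMonoid public
    using () renaming (∙-distrʳ-∙ to ∨-distribʳ-∨)
  open GroupProperties ⊕-⊥-group using (x∙y⁻¹≈ε⇒x≈y)

  x≈⊥⇒x∨y≈y : ∀ {x} y → x ≈ ⊥ → x ∨ y ≈ y
  x≈⊥⇒x∨y≈y y x≈⊥ = trans (∨-congʳ x≈⊥) (∨-identityˡ y)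

  x∨y≈⊥⇒x≈⊥ : ∀ x y → x ∨ y ≈ ⊥ → x ≈ ⊥
  x∨y≈⊥⇒x≈⊥ x y x∨y≈⊥ = begin
    x            ≈⟨ ∧-absorbs-∨ x y ⟨
    x ∧ (x ∨ y)  ≈⟨ ∧-congˡ x∨y≈⊥ ⟩
    x ∧ ⊥        ≈⟨ ∧-zeroʳ x ⟩
    ⊥            ∎

  x∨y≈⊥⇒y≈⊥ : ∀ x y → x ∨ y ≈ ⊥ → y ≈ ⊥
  x∨y≈⊥⇒y≈⊥ x y x∨y≈⊥ = x∨y≈⊥⇒x≈⊥ y x (trans (∨-comm y x) x∨y≈⊥)

  ∧¬-absorbs-∨ : ∀ x d → (x ∨ d) ∧ ¬ d ≈ x ∧ ¬ d
  ∧¬-absorbs-∨ x d = begin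
    (x ∨ d) ∧ ¬ d            ≈⟨ ∧-distribʳ-∨ (¬ d) x d ⟩
    (x ∧ ¬ d) ∨ (d ∧ ¬ d)    ≈⟨ ∨-congˡ (∧-complementʳ d) ⟩
    (x ∧ ¬ d) ∨ ⊥            ≈⟨ ∨-identityʳ _ ⟩
    x ∧ ¬ d                  ∎

  ∨-absorbs-∧¬ : ∀ x d → (x ∧ ¬ d) ∨ d ≈ x ∨ d
  ∨-absorbs-∧¬ x d = begin
    (x ∧ ¬ d) ∨ d            ≈⟨ ∨-distribʳ-∧ d x (¬ d) ⟩
    (x ∨ d) ∧ (¬ d ∨ d)      ≈⟨ ∧-congˡ (∨-complementˡ d) ⟩
    (x ∨ d) ∧ ⊤              ≈⟨ ∧-identityʳ _ ⟩
    x ∨ d                    ∎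

  x∨d≈y∨d⇒x⊕y≤d : ∀ {x y d} → x ∨ d ≈ y ∨ d → _≤_ B (x ⊕ y) d
  x∨d≈y∨d⇒x⊕y≤d {x} {y} {d} x∨d≈y∨d = begin
    (x ⊕ y) ∨ d                    ≈⟨ ∨-absorbs-∧¬ (x ⊕ y) d ⟨
    ((x ⊕ y) ∧ ¬ d) ∨ d            ≈⟨ ∨-congʳ (∧-distribʳ-⊕ (¬ d) x y) ⟩
    ((x ∧ ¬ d) ⊕ (y ∧ ¬ d)) ∨ d    ≈⟨ ∨-congʳ (⊕-cong x∧¬d≈y∧¬d refl) ⟩
    ((y ∧ ¬ d) ⊕ (y ∧ ¬ d)) ∨ d    ≈⟨ ∨-congʳ (⊕-inverseʳ (y ∧ ¬ d)) ⟩
    ⊥ ∨ d                          ≈⟨ ∨-identityˡ d ⟩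
    d                              ∎
    where
    x∧¬d≈y∧¬d : x ∧ ¬ d ≈ y ∧ ¬ d
    x∧¬d≈y∧¬d = begin
      x ∧ ¬ d        ≈⟨ ∧¬-absorbs-∨ x d ⟨
      (x ∨ d) ∧ ¬ d  ≈⟨ ∧-congʳ x∨d≈y∨d ⟩
      (y ∨ d) ∧ ¬ d  ≈⟨ ∧¬-absorbs-∨ y d ⟩
      y ∧ ¬ d        ∎

  x≤y⇒y∨¬x≈⊤ : ∀ {x y} → _≤_ B x y → y ∨ ¬ x ≈ ⊤
  x≤y⇒y∨¬x≈⊤ {x} {y} x≤y = begin
    y ∨ ¬ x          ≈⟨ ∨-congʳ x≤y ⟨
    (x ∨ y) ∨ ¬ x    ≈⟨ ∨-congʳ (∨-comm x y) ⟩
    (y ∨ x) ∨ ¬ x    ≈⟨ ∨-assoc y x (¬ x) ⟩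
    y ∨ (x ∨ ¬ x)    ≈⟨ ∨-congˡ (∨-complementʳ x) ⟩
    y ∨ ⊤            ≈⟨ ∨-zeroʳ y ⟩
    ⊤                ∎

  ¬[x⊕y]≈⊤⇒x≈y : ∀ {x y} → ¬ (x ⊕ y) ≈ ⊤ → x ≈ y
  ¬[x⊕y]≈⊤⇒x≈y {x} {y} ¬[x⊕y]≈⊤ = x∙y⁻¹≈ε⇒x≈y x y (begin
    x ⊕ y          ≈⟨ ¬-involutive (x ⊕ y) ⟨
    ¬ ¬ (x ⊕ y)    ≈⟨ ¬-cong ¬[x⊕y]≈⊤ ⟩
    ¬ ⊤            ≈⟨ ¬⊤≈⊥ ⟩
    ⊥              ∎)

module IdealCongruence {c ℓ : Level} (B : BooleanAlgebra c ℓ)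
  {f : Op₁ (BooleanAlgebra.Carrier B)} (f-modal : IsModalOperator B f) where

  open BooleanAlgebra B
  open BooleanAlgebraFacts B
  open IsModalOperator f-modal renaming (cong to f-cong)
  open BooleanAlgebraProperties B using (_⊕_; ∨-identityˡ; deMorgan₂)
  open LatticeProperties lattice using (∨-idem)
  open SetoidReasoning setoid

  _≈_mod↓_ : Carrier → Carrier → Carrier → Set (c ⊔ ℓ)
  x ≈ y mod↓ d = Lift c (x ∨ d ≈ y ∨ d)

  mod↓-isCongruence : ∀ {d} → _≤_ B (f d) d → IsCongruence B f (_≈_mod↓ d)
  mod↓-isCongruence {d} fd≤d = record
    { isEquivalence = record
      { refl  = lift refl
      ; sym   = λ x≈y → lift (sym (lower x≈y))
      ; trans = λ x≈y y≈z → lift (trans (lower x≈y) (lower y≈z))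
      }
    ; ≈⇒θ    = λ x≈y → lift (∨-congʳ x≈y)
    ; ∨-cong = λ {x y u v} x≈y u≈v → lift (begin
        (x ∨ u) ∨ d        ≈⟨ ∨-distribʳ-∨ d x u ⟩
        (x ∨ d) ∨ (u ∨ d)  ≈⟨ ∨-cong (lower x≈y) (lower u≈v) ⟩
        (y ∨ d) ∨ (v ∨ d)  ≈⟨ ∨-distribʳ-∨ d y v ⟨
        (y ∨ v) ∨ d        ∎)
    ; ∧-cong = λ {x y u v} x≈y u≈v → lift (begin
        (x ∧ u) ∨ d        ≈⟨ ∨-distribʳ-∧ d x u ⟩
        (x ∨ d) ∧ (u ∨ d)  ≈⟨ ∧-cong (lower x≈y) (lower u≈v) ⟩
        (y ∨ d) ∧ (v ∨ d)  ≈⟨ ∨-distribʳ-∧ d y v ⟨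
        (y ∧ v) ∨ d        ∎)
    ; ¬-cong = λ {x y} x≈y → lift (begin
        ¬ x ∨ d            ≈⟨ ∨-absorbs-∧¬ (¬ x) d ⟨
        (¬ x ∧ ¬ d) ∨ d    ≈⟨ ∨-congʳ (deMorgan₂ x d) ⟨
        ¬ (x ∨ d) ∨ d      ≈⟨ ∨-congʳ (¬-cong (lower x≈y)) ⟩
        ¬ (y ∨ d) ∨ d      ≈⟨ ∨-congʳ (deMorgan₂ y d) ⟩
        (¬ y ∧ ¬ d) ∨ d    ≈⟨ ∨-absorbs-∧¬ (¬ y) d ⟩
        ¬ y ∨ d            ∎)
    ; f-cong = λ {x y} x≈y → lift (begin
        f x ∨ d            ≈⟨ ∨-congˡ fd≤d ⟨
        f x ∨ (f d ∨ d)    ≈⟨ ∨-assoc (f x) (f d) d ⟨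
        (f x ∨ f d) ∨ d    ≈⟨ ∨-congʳ (additive x d) ⟨
        f (x ∨ d) ∨ d      ≈⟨ ∨-congʳ (f-cong (lower x≈y)) ⟩
        f (y ∨ d) ∨ d      ≈⟨ ∨-congʳ (additive y d) ⟩
        (f y ∨ f d) ∨ d    ≈⟨ ∨-assoc (f y) (f d) d ⟩
        f y ∨ (f d ∨ d)    ≈⟨ ∨-congˡ fd≤d ⟩
        f y ∨ d            ∎)
    }

  monolith-⊕-below-closed :
    ∀ {a b} →
    ((θ : Rel Carrier (c ⊔ ℓ)) → IsCongruence B f θ →
       (∃[ x ] ∃[ y ] (θ x y × x ≉ y)) → θ a b) →
    ∀ {d} → _≤_ B (f d) d → d ≉ ⊥ → _≤_ B (a ⊕ b) d
  monolith-⊕-below-closed monolith {d} fd≤d d≉⊥ =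
    x∨d≈y∨d⇒x⊕y≤d (lower (monolith (_≈_mod↓ d) (mod↓-isCongruence fd≤d)
      (d , ⊥ , lift (trans (∨-idem d) (sym (∨-identityˡ d))) , d≉⊥)))

module NonzeroTo {c ℓ : Level} (em : ExcludedMiddle (c ⊔ ℓ)) (B : BooleanAlgebra c ℓ) where

  open BooleanAlgebra B hiding (¬_)
  open import Relation.Nullary using (¬_)
  open BooleanAlgebraFacts B
  open BooleanAlgebraProperties B using (∨-identityˡ; ∨-identityʳ)
  open LatticeProperties lattice using (∨-idem)

  isZero? : ∀ x → Dec (x ≈ ⊥)
  isZero? x = map′ lower lift (em {Lift c (x ≈ ⊥)})

  nonzeroTo : Carrier → Op₁ Carrier
  nonzeroTo k x with isZero? x
  ... | yes _ = ⊥
  ... | no  _ = k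

  module _ (k : Carrier) where

    nonzeroTo-zero : ∀ {x} → x ≈ ⊥ → nonzeroTo k x ≈ ⊥
    nonzeroTo-zero {x} x≈⊥ with isZero? x
    ... | yes _   = refl
    ... | no  x≉⊥ = contradiction x≈⊥ x≉⊥

    nonzeroTo-nonzero : ∀ {x} → x ≉ ⊥ → nonzeroTo k x ≈ k
    nonzeroTo-nonzero {x} x≉⊥ with isZero? x
    ... | yes x≈⊥ = contradiction x≈⊥ x≉⊥
    ... | no  _   = refl

    nonzeroTo-cong : ∀ {x y} → x ≈ y → nonzeroTo k x ≈ nonzeroTo k y
    nonzeroTo-cong {x} {y} x≈y with isZero? x
    ... | yes x≈⊥ = sym (nonzeroTo-zero (trans (sym x≈y) x≈⊥))
    ... | no  x≉⊥ = sym (nonzeroTo-nonzero (x≉⊥ ∘ trans x≈y))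

    nonzeroTo-additive : ∀ x y → nonzeroTo k (x ∨ y) ≈ nonzeroTo k x ∨ nonzeroTo k y
    nonzeroTo-additive x y with isZero? x | isZero? y
    ... | yes x≈⊥ | yes y≈⊥ =
      trans (nonzeroTo-zero (trans (x≈⊥⇒x∨y≈y y x≈⊥) y≈⊥)) (sym (∨-idem ⊥))
    ... | yes _   | no  y≉⊥ =
      trans (nonzeroTo-nonzero (y≉⊥ ∘ x∨y≈⊥⇒y≈⊥ x y)) (sym (∨-identityˡ k))
    ... | no  x≉⊥ | yes _   =
      trans (nonzeroTo-nonzero (x≉⊥ ∘ x∨y≈⊥⇒x≈⊥ x y)) (sym (∨-identityʳ k))
    ... | no  x≉⊥ | no  _   =
      trans (nonzeroTo-nonzero (x≉⊥ ∘ x∨y≈⊥⇒x≈⊥ x y)) (sym (∨-idem k))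

    nonzeroTo-isModalOperator : IsModalOperator B (nonzeroTo k)
    nonzeroTo-isModalOperator = record
      { cong     = nonzeroTo-cong
      ; normal   = nonzeroTo-zero refl
      ; additive = nonzeroTo-additive
      }

  hasProperCompanion : ∀ {f k} → Nontrivial B → k ≉ ⊤ →
                       (∀ x → x ≉ ⊥ → f x ∨ k ≈ ⊤) → HasProperCompanion B f
  hasProperCompanion {f} {k} ⊤≉⊥ k≉⊤ fx∨k≈⊤ =
    nonzeroTo k , (nonzeroTo-isModalOperator k , isCompanion) , notDiscriminator
    where
    isCompanion : ∀ x → x ≉ ⊥ → f x ∨ nonzeroTo k x ≈ ⊤
    isCompanion x x≉⊥ = trans (∨-congˡ (nonzeroTo-nonzero k x≉⊥)) (fx∨k≈⊤ x x≉⊥)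

    notDiscriminator : ¬ IsDiscriminator B (nonzeroTo k)
    notDiscriminator (_ , nonzero↦⊤) =
      k≉⊤ (trans (sym (nonzeroTo-nonzero k ⊤≉⊥)) (nonzero↦⊤ ⊤ ⊤≉⊥))

mainTheorem18 : {c ℓ : Level} → ExcludedMiddle (c ⊔ ℓ) →
    (B : BooleanAlgebra c ℓ) → (f : Op₁ (BooleanAlgebra.Carrier B)) →
    Nontrivial B → IsModalOperator B f → SubdirectlyIrreducible B f →
    IsClosureOperator B f → HasProperCompanion B f
mainTheorem18 em B f ⊤≉⊥ f-modal (a , b , a≉b , monolith) (inflationary , idempotent) =
  hasProperCompanion ⊤≉⊥ (a≉b ∘ ¬[x⊕y]≈⊤⇒x≈y) fx∨¬[a⊕b]≈⊤
  where
  open BooleanAlgebra B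
  open BooleanAlgebraFacts B
  open BooleanAlgebraProperties B using (_⊕_)
  open LatticeProperties lattice using (∨-idem)
  open IdealCongruence B f-modal using (monolith-⊕-below-closed)
  open NonzeroTo em B using (hasProperCompanion)

  f-closed : ∀ x → _≤_ B (f (f x)) (f x)
  f-closed x = trans (∨-congʳ (idempotent x)) (∨-idem (f x))

  f-nonzero : ∀ {x} → x ≉ ⊥ → f x ≉ ⊥
  f-nonzero {x} x≉⊥ fx≈⊥ = x≉⊥ (x∨y≈⊥⇒x≈⊥ x (f x) (trans (inflationary x) fx≈⊥))

  fx∨¬[a⊕b]≈⊤ : ∀ x → x ≉ ⊥ → f x ∨ ¬ (a ⊕ b) ≈ ⊤
  fx∨¬[a⊕b]≈⊤ x x≉⊥ =
    x≤y⇒y∨¬x≈⊤ (monolith-⊕-below-closed monolith (f-closed x) (f-nonzero x≉⊥))
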